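{- Let $\alpha$ be a positive integer, $R$ a parameter, and let $h>n\ge0$ be integers. Then the coefficient $C_{h,n}(\alpha,R)=[z^n]P_h(\alpha,R;z)$ satisfies \[ C_{h,n}(\alpha,R)=\sum_{i=0}^{n}\binom{h}{i}(-1)^i\,p_i\bigl(-\alpha,R+(h-1)\alpha\bigr)\,p_{n-i}(\alpha,R) =\alpha^n\sum_{i=0}^{n}\binom{h}{i}\left(1-h-\tfrac{R}{\alpha}\right)_i\left(\tfrac{R}{\alpha}\right)_{n-i}. \]
   Context: For $n\ge0$, $p_n(\alpha,R)=\prod_{j=0}^{n-1}(R+\alpha j)$ with $p_0=1$ (defined for any $\alpha$, including negative values). $(x)_n=x(x+1)\cdots(x+n-1)$ is the Pochhammer symbol. $P_h(\alpha,R;z)$ is defined by $P_h=(1-(R+2\alpha(h-1))z)P_{h-1}-\alpha(R+\alpha(h-2))(h-1)z^2P_{h-2}$ for $h\ge2$, $P_1=1$, $P_h=0$ for $h\le0$. -}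

module Defs where

open import Data.Nat as ℕ using (ℕ; zero; suc; NonZero)
open import Data.Nat.Combinatorics using (_C_)
open import Data.Integer using (+_)
open import Data.Rational using (ℚ; _+_; _*_; _-_; -_; _/_; 0ℚ; 1ℚ)

⟦_⟧ : ℕ → ℚ
⟦ n ⟧ = (+ n) / 1

sumTo : ℕ → (ℕ → ℚ) → ℚ
sumTo zero    f = f 0
sumTo (suc n) f = sumTo n f + f (suc n)

sgn : ℕ → ℚ
sgn zero    = 1ℚ
sgn (suc i) = - sgn i

pow : ℚ → ℕ → ℚ
pow a zero    = 1ℚ
pow a (suc n) = pow a n * a

p : ℕ → ℚ → ℚ → ℚ
p zero    α R = 1ℚ
p (suc n) α R = p n α R * (R + α * ⟦ n ⟧)

poch : ℚ → ℕ → ℚ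
poch x zero    = 1ℚ
poch x (suc n) = poch x n * (x + ⟦ n ⟧)

-- Polynomials in z with ℚ coefficients, represented by their coefficient sequence
Poly : Set
Poly = ℕ → ℚ

zShift : Poly → Poly
zShift f zero    = 0ℚ
zShift f (suc n) = f n

_⊕_ : Poly → Poly → Poly
(f ⊕ g) n = f n + g n

_⊖_ : Poly → Poly → Poly
(f ⊖ g) n = f n - g n

_·_ : ℚ → Poly → Poly
(c · f) n = c * f n

one : Poly
one zero    = 1ℚ
one (suc n) = 0ℚ

zero-poly : Poly
zero-poly n = 0ℚ

-- P_h(α,R;z):  P_h = 0 for h ≤ 0, P_1 = 1, and for h ≥ 2
--   P_h = (1 - (R + 2α(h-1)) z) P_{h-1} - α (R + α(h-2)) (h-1) z² P_{h-2}.
-- Here h = k+2, so h-1 = k+1, h-2 = k.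
P : ℚ → ℚ → ℕ → Poly
P α R zero = zero-poly
P α R (suc zero) = one
P α R (suc (suc k)) =
  (P α R (suc k) ⊖ ((R + ⟦ 2 ⟧ * α * ⟦ suc k ⟧) · zShift (P α R (suc k))))
  ⊖ ((α * (R + α * ⟦ k ⟧) * ⟦ suc k ⟧) · zShift (zShift (P α R k)))

coeffC : ℚ → ℚ → ℕ → ℕ → ℚ
coeffC α R h n = P α R h n

-- Let B(z) = Σₘ pₘ(α,R) zᵐ and U_h(z) = Σᵢ (h choose i) pᵢ(α, Z_h) zⁱ with Z_h = −(R + (h−1)α).
-- A binomial identity shows that the coefficients of U_h obey the three-term recurrence
-- defining P_h, and multiplication by B commutes with that recurrence, so T_h = U_h·B obeys it
-- too. Hence P_h and T_h agree in degrees < h by induction on h: the only extra input is the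
-- coefficient of z^(k+1) in P_(k+1), which is 0 for degree reasons, while the one of T_(k+1) is
-- p_(k+1)(α, R + Z_(k+1)) = p_(k+1)(α, −kα) = 0 by the Chu–Vandermonde identity for pₘ.
-- Both closed forms are T_h rewritten by (−1)ⁱ pᵢ(−α,Y) = pᵢ(α,−Y) and pᵢ(α,αx) = αⁱ (x)ᵢ.
module Submission where

open import Defs
open import Data.Nat as ℕ using (ℕ; NonZero; _<_; _∸_)
open import Data.Nat.Combinatorics using (_C_)
open import Data.Integer using (+_)
open import Data.Rational using (ℚ; _+_; _*_; _-_; -_; _/_; 1ℚ)
open import Data.Product using (_×_)
open import Relation.Binary.PropositionalEquality using (_≡_)

open import Data.Nat using (zero; suc; z≤n; s≤s; _≤_)
import Data.Nat.Properties as ℕP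
import Data.Nat.Combinatorics as ℕC
import Data.Nat.Coprimality as Coprime
import Data.Nat.Solver
import Data.Integer as ℤ
import Data.Integer.Properties as ℤP
open import Data.Rational using (mkℚ; 0ℚ)
import Data.Rational.Properties as ℚP
open import Data.Rational.Solver using (module +-*-Solver)
open import Data.Product using (_,_)
open import Data.Sum using (inj₁; inj₂)
open import Relation.Binary.PropositionalEquality
  using (refl; sym; trans; cong; cong₂; module ≡-Reasoning)

open +-*-Solver using (solve; _:+_; _:*_; :-_; _:-_; con; _:=_)
open ≡-Reasoning

⟦⟧≡mkℚ : ∀ n → ⟦ n ⟧ ≡ mkℚ (+ n) 0 (Coprime.sym (Coprime.1-coprimeTo n))
⟦⟧≡mkℚ n = ℚP.normalize-coprime (Coprime.sym (Coprime.1-coprimeTo n))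

⟦⟧-suc : ∀ n → ⟦ suc n ⟧ ≡ ⟦ n ⟧ + 1ℚ
⟦⟧-suc n rewrite ⟦⟧≡mkℚ n = ℚP./-cong {+ suc n} {1} numerators refl
  where
  numerators : + suc n ≡ + n ℤ.* + 1 ℤ.+ + 1 ℤ.* + 1
  numerators = trans (cong +_ (ℕP.+-comm 1 n)) (cong (ℤ._+ + 1) (sym (ℤP.*-identityʳ (+ n))))

⟦⟧-homo-+ : ∀ m n → ⟦ m ℕ.+ n ⟧ ≡ ⟦ m ⟧ + ⟦ n ⟧
⟦⟧-homo-+ zero    n = sym (ℚP.+-identityˡ ⟦ n ⟧)
⟦⟧-homo-+ (suc m) n = begin
  ⟦ suc (m ℕ.+ n) ⟧      ≡⟨ ⟦⟧-suc (m ℕ.+ n) ⟩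
  ⟦ m ℕ.+ n ⟧ + 1ℚ       ≡⟨ cong (_+ 1ℚ) (⟦⟧-homo-+ m n) ⟩
  (⟦ m ⟧ + ⟦ n ⟧) + 1ℚ   ≡⟨ solve 2 (λ x y → (x :+ y) :+ con 1ℚ := (x :+ con 1ℚ) :+ y) refl ⟦ m ⟧ ⟦ n ⟧ ⟩
  (⟦ m ⟧ + 1ℚ) + ⟦ n ⟧   ≡⟨ cong (_+ ⟦ n ⟧) (sym (⟦⟧-suc m)) ⟩
  ⟦ suc m ⟧ + ⟦ n ⟧      ∎

⟦⟧-homo-* : ∀ m n → ⟦ m ℕ.* n ⟧ ≡ ⟦ m ⟧ * ⟦ n ⟧
⟦⟧-homo-* zero    n = sym (ℚP.*-zeroˡ ⟦ n ⟧)
⟦⟧-homo-* (suc m) n = begin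
  ⟦ n ℕ.+ m ℕ.* n ⟧       ≡⟨ ⟦⟧-homo-+ n (m ℕ.* n) ⟩
  ⟦ n ⟧ + ⟦ m ℕ.* n ⟧     ≡⟨ cong (λ t → ⟦ n ⟧ + t) (⟦⟧-homo-* m n) ⟩
  ⟦ n ⟧ + ⟦ m ⟧ * ⟦ n ⟧   ≡⟨ solve 2 (λ x y → y :+ x :* y := (x :+ con 1ℚ) :* y) refl ⟦ m ⟧ ⟦ n ⟧ ⟩
  (⟦ m ⟧ + 1ℚ) * ⟦ n ⟧    ≡⟨ cong (_* ⟦ n ⟧) (sym (⟦⟧-suc m)) ⟩
  ⟦ suc m ⟧ * ⟦ n ⟧       ∎

⟦⟧*1/≡1 : ∀ n .{{_ : NonZero n}} → ⟦ n ⟧ * ((+ 1) / n) ≡ 1ℚ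
⟦⟧*1/≡1 (suc n) = begin
  ⟦ suc n ⟧ * ((+ 1) / suc n)
    ≡⟨ cong₂ _*_ (⟦⟧≡mkℚ (suc n)) (ℚP.normalize-coprime (Coprime.1-coprimeTo (suc n))) ⟩
  mkℚ (+ suc n) 0 (Coprime.sym (Coprime.1-coprimeTo (suc n))) * mkℚ (+ 1) n (Coprime.1-coprimeTo (suc n))
    ≡⟨ ℚP.*-inverseʳ (mkℚ (+ suc n) 0 (Coprime.sym (Coprime.1-coprimeTo (suc n)))) ⟩
  1ℚ ∎

absorption : ∀ n k → suc k ℕ.* (suc n C suc k) ≡ suc n ℕ.* (n C k)
absorption zero    zero    = refl
absorption zero    (suc k) = ℕP.*-zeroʳ (suc (suc k))
absorption (suc n) zero    = trans (ℕP.+-identityʳ (suc (suc n) C 1))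
  (trans (ℕC.nC1≡n (suc (suc n))) (sym (ℕP.*-identityʳ (suc (suc n)))))
absorption (suc n) (suc k) = begin
  suc (suc k) ℕ.* (suc (suc n) C suc (suc k))
    ≡⟨ cong (suc (suc k) ℕ.*_) (sym (ℕC.nCk+nC[k+1]≡[n+1]C[k+1] (suc n) (suc k))) ⟩
  suc (suc k) ℕ.* (c₁ ℕ.+ c₂)
    ≡⟨ NS.solve 3 (λ k c₁ c₂ → (NS.con 2 NS.:+ k) NS.:* (c₁ NS.:+ c₂)
         NS.:= c₁ NS.:+ (NS.con 1 NS.:+ k) NS.:* c₁ NS.:+ (NS.con 2 NS.:+ k) NS.:* c₂) refl k c₁ c₂ ⟩
  c₁ ℕ.+ suc k ℕ.* c₁ ℕ.+ suc (suc k) ℕ.* c₂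
    ≡⟨ cong₂ (λ x y → c₁ ℕ.+ x ℕ.+ y) (absorption n k) (absorption n (suc k)) ⟩
  c₁ ℕ.+ suc n ℕ.* (n C k) ℕ.+ suc n ℕ.* (n C suc k)
    ≡⟨ NS.solve 4 (λ n c₁ d₁ d₂ → c₁ NS.:+ (NS.con 1 NS.:+ n) NS.:* d₁ NS.:+ (NS.con 1 NS.:+ n) NS.:* d₂
         NS.:= c₁ NS.:+ (NS.con 1 NS.:+ n) NS.:* (d₁ NS.:+ d₂)) refl n c₁ (n C k) (n C suc k) ⟩
  c₁ ℕ.+ suc n ℕ.* (n C k ℕ.+ n C suc k)
    ≡⟨ cong (λ x → c₁ ℕ.+ suc n ℕ.* x) (ℕC.nCk+nC[k+1]≡[n+1]C[k+1] n k) ⟩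
  suc (suc n) ℕ.* c₁ ∎
  where
  module NS = Data.Nat.Solver.+-*-Solver
  c₁ = suc n C suc k
  c₂ = suc n C suc (suc k)

pascal-⟦⟧ : ∀ n k → ⟦ n C k ⟧ + ⟦ n C suc k ⟧ ≡ ⟦ suc n C suc k ⟧
pascal-⟦⟧ n k = trans (sym (⟦⟧-homo-+ (n C k) (n C suc k))) (cong ⟦_⟧ (ℕC.nCk+nC[k+1]≡[n+1]C[k+1] n k))

absorption-⟦⟧ : ∀ n k → ⟦ suc k ⟧ * ⟦ suc n C suc k ⟧ ≡ ⟦ suc n ⟧ * ⟦ n C k ⟧
absorption-⟦⟧ n k = begin
  ⟦ suc k ⟧ * ⟦ suc n C suc k ⟧  ≡⟨ sym (⟦⟧-homo-* (suc k) (suc n C suc k)) ⟩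
  ⟦ suc k ℕ.* (suc n C suc k) ⟧  ≡⟨ cong ⟦_⟧ (absorption n k) ⟩
  ⟦ suc n ℕ.* (n C k) ⟧          ≡⟨ ⟦⟧-homo-* (suc n) (n C k) ⟩
  ⟦ suc n ⟧ * ⟦ n C k ⟧          ∎

sumTo-cong : ∀ n {f g : ℕ → ℚ} → (∀ i → f i ≡ g i) → sumTo n f ≡ sumTo n g
sumTo-cong zero    f≗g = f≗g 0
sumTo-cong (suc n) f≗g = cong₂ _+_ (sumTo-cong n f≗g) (f≗g (suc n))

sumTo-cong≤ : ∀ n {f g : ℕ → ℚ} → (∀ i → i ≤ n → f i ≡ g i) → sumTo n f ≡ sumTo n g
sumTo-cong≤ zero    f≗g = f≗g 0 z≤n
sumTo-cong≤ (suc n) f≗g =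
  cong₂ _+_ (sumTo-cong≤ n (λ i i≤n → f≗g i (ℕP.m≤n⇒m≤1+n i≤n))) (f≗g (suc n) ℕP.≤-refl)

sumTo-sucˡ : ∀ n (f : ℕ → ℚ) → sumTo (suc n) f ≡ f 0 + sumTo n (λ i → f (suc i))
sumTo-sucˡ zero    f = refl
sumTo-sucˡ (suc n) f = trans (cong (_+ f (suc (suc n))) (sumTo-sucˡ n f))
  (ℚP.+-assoc (f 0) (sumTo n (λ i → f (suc i))) (f (suc (suc n))))

sumTo-*ˡ : ∀ n c (f : ℕ → ℚ) → sumTo n (λ i → c * f i) ≡ c * sumTo n f
sumTo-*ˡ zero    c f = refl
sumTo-*ˡ (suc n) c f = trans (cong (_+ c * f (suc n)) (sumTo-*ˡ n c f))
  (sym (ℚP.*-distribˡ-+ c (sumTo n f) (f (suc n))))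

sumTo-+ : ∀ n (f g : ℕ → ℚ) → sumTo n (λ i → f i + g i) ≡ sumTo n f + sumTo n g
sumTo-+ zero    f g = refl
sumTo-+ (suc n) f g = trans (cong (_+ (f (suc n) + g (suc n))) (sumTo-+ n f g))
  (solve 4 (λ a b c d → (a :+ b) :+ (c :+ d) := (a :+ c) :+ (b :+ d)) refl
    (sumTo n f) (sumTo n g) (f (suc n)) (g (suc n)))

sumTo-- : ∀ n (f g : ℕ → ℚ) → sumTo n (λ i → f i - g i) ≡ sumTo n f - sumTo n g
sumTo-- zero    f g = refl
sumTo-- (suc n) f g = trans (cong (_+ (f (suc n) - g (suc n))) (sumTo-- n f g))
  (solve 4 (λ a b c d → (a :- b) :+ (c :- d) := (a :+ c) :- (b :+ d)) refl
    (sumTo n f) (sumTo n g) (f (suc n)) (g (suc n)))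

pascal-sum : ∀ m (G : ℕ → ℚ) →
  sumTo (suc m) (λ i → ⟦ suc m C i ⟧ * G i)
    ≡ sumTo m (λ i → ⟦ m C i ⟧ * G i) + sumTo m (λ i → ⟦ m C i ⟧ * G (suc i))
pascal-sum m G = begin
  sumTo (suc m) (λ i → ⟦ suc m C i ⟧ * G i)
    ≡⟨ sumTo-sucˡ m (λ i → ⟦ suc m C i ⟧ * G i) ⟩
  G₀ + sumTo m (λ i → ⟦ suc m C suc i ⟧ * G (suc i))
    ≡⟨ cong (λ t → G₀ + t) (sumTo-cong m split) ⟩
  G₀ + sumTo m (λ i → ⟦ m C i ⟧ * G (suc i) + ⟦ m C suc i ⟧ * G (suc i))
    ≡⟨ cong (λ t → G₀ + t) (sumTo-+ m _ _) ⟩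
  G₀ + (S₁ + S₂)
    ≡⟨ solve 3 (λ a b c → a :+ (b :+ c) := (a :+ c) :+ b) refl G₀ S₁ S₂ ⟩
  (G₀ + S₂) + S₁
    ≡⟨ cong (_+ S₁) (sym (sumTo-sucˡ m (λ i → ⟦ m C i ⟧ * G i))) ⟩
  sumTo m (λ i → ⟦ m C i ⟧ * G i) + ⟦ m C suc m ⟧ * G (suc m) + S₁
    ≡⟨ cong (λ t → sumTo m (λ i → ⟦ m C i ⟧ * G i) + t + S₁) top-vanishes ⟩
  sumTo m (λ i → ⟦ m C i ⟧ * G i) + 0ℚ + S₁
    ≡⟨ cong (_+ S₁) (ℚP.+-identityʳ (sumTo m (λ i → ⟦ m C i ⟧ * G i))) ⟩
  sumTo m (λ i → ⟦ m C i ⟧ * G i) + S₁ ∎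
  where
  G₀ = ⟦ 1 ⟧ * G 0
  S₁ = sumTo m (λ i → ⟦ m C i ⟧ * G (suc i))
  S₂ = sumTo m (λ i → ⟦ m C suc i ⟧ * G (suc i))
  split : ∀ i → ⟦ suc m C suc i ⟧ * G (suc i) ≡ ⟦ m C i ⟧ * G (suc i) + ⟦ m C suc i ⟧ * G (suc i)
  split i = trans (cong (_* G (suc i)) (sym (pascal-⟦⟧ m i))) (ℚP.*-distribʳ-+ (G (suc i)) ⟦ m C i ⟧ ⟦ m C suc i ⟧)
  top-vanishes : ⟦ m C suc m ⟧ * G (suc m) ≡ 0ℚ
  top-vanishes = trans (cong (λ c → ⟦ c ⟧ * G (suc m)) (ℕC.k>n⇒nCk≡0 (ℕP.n<1+n m)))
    (ℚP.*-zeroˡ (G (suc m)))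

p-sucˡ : ∀ α n X → p (suc n) α X ≡ X * p n α (X + α)
p-sucˡ α zero    X = solve 2 (λ x a → con 1ℚ :* (x :+ a :* con 0ℚ) := x :* con 1ℚ) refl X α
p-sucˡ α (suc n) X = begin
  p (suc n) α X * (X + α * ⟦ suc n ⟧)
    ≡⟨ cong₂ (λ u v → u * (X + α * v)) (p-sucˡ α n X) (⟦⟧-suc n) ⟩
  X * p n α (X + α) * (X + α * (⟦ n ⟧ + 1ℚ))
    ≡⟨ solve 4 (λ x a q m → x :* q :* (x :+ a :* (m :+ con 1ℚ)) := x :* (q :* ((x :+ a) :+ a :* m)))
         refl X α (p n α (X + α)) ⟦ n ⟧ ⟩
  X * (p n α (X + α) * ((X + α) + α * ⟦ n ⟧)) ∎

sgn*p-neg : ∀ α Y i → sgn i * p i (- α) Y ≡ p i α (- Y)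
sgn*p-neg α Y zero    = refl
sgn*p-neg α Y (suc i) = begin
  (- sgn i) * (p i (- α) Y * (Y + (- α) * ⟦ i ⟧))
    ≡⟨ solve 5 (λ s q y a m → (:- s) :* (q :* (y :+ (:- a) :* m)) := (s :* q) :* ((:- y) :+ a :* m))
         refl (sgn i) (p i (- α) Y) Y α ⟦ i ⟧ ⟩
  (sgn i * p i (- α) Y) * ((- Y) + α * ⟦ i ⟧)
    ≡⟨ cong (_* ((- Y) + α * ⟦ i ⟧)) (sgn*p-neg α Y i) ⟩
  p i α (- Y) * ((- Y) + α * ⟦ i ⟧) ∎

p≡pow*poch : ∀ α x i → p i α (α * x) ≡ pow α i * poch x i
p≡pow*poch α x zero    = refl
p≡pow*poch α x (suc i) = begin
  p i α (α * x) * (α * x + α * ⟦ i ⟧)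
    ≡⟨ cong (_* (α * x + α * ⟦ i ⟧)) (p≡pow*poch α x i) ⟩
  pow α i * poch x i * (α * x + α * ⟦ i ⟧)
    ≡⟨ solve 5 (λ w q a x m → w :* q :* (a :* x :+ a :* m) := (w :* a) :* (q :* (x :+ m)))
         refl (pow α i) (poch x i) α x ⟦ i ⟧ ⟩
  (pow α i * α) * (poch x i * (x + ⟦ i ⟧)) ∎

pow-+ : ∀ α m n → pow α (m ℕ.+ n) ≡ pow α m * pow α n
pow-+ α zero    n = sym (ℚP.*-identityˡ (pow α n))
pow-+ α (suc m) n = trans (cong (_* α) (pow-+ α m n))
  (solve 3 (λ x y a → x :* y :* a := (x :* a) :* y) refl (pow α m) (pow α n) α)

p-vandermonde : ∀ α m X Y →
  sumTo m (λ i → ⟦ m C i ⟧ * p i α Y * p (m ∸ i) α X) ≡ p m α (X + Y)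
p-vandermonde α zero    X Y = refl
p-vandermonde α (suc m) X Y = begin
  sumTo (suc m) (λ i → ⟦ suc m C i ⟧ * p i α Y * p (suc m ∸ i) α X)
    ≡⟨ sumTo-cong (suc m) (λ i → ℚP.*-assoc ⟦ suc m C i ⟧ _ _) ⟩
  sumTo (suc m) (λ i → ⟦ suc m C i ⟧ * G i)
    ≡⟨ pascal-sum m G ⟩
  sumTo m (λ i → ⟦ m C i ⟧ * G i) + sumTo m (λ i → ⟦ m C i ⟧ * G (suc i))
    ≡⟨ cong₂ _+_ lower-X upper-Y ⟩
  X * p m α ((X + α) + Y) + Y * p m α (X + (Y + α))
    ≡⟨ cong₂ (λ u v → X * p m α u + Y * p m α v)
         (solve 3 (λ x a y → (x :+ a) :+ y := (x :+ y) :+ a) refl X α Y)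
         (solve 3 (λ x a y → x :+ (y :+ a) := (x :+ y) :+ a) refl X α Y) ⟩
  X * p m α ((X + Y) + α) + Y * p m α ((X + Y) + α)
    ≡⟨ sym (ℚP.*-distribʳ-+ _ X Y) ⟩
  (X + Y) * p m α ((X + Y) + α)
    ≡⟨ sym (p-sucˡ α m (X + Y)) ⟩
  p (suc m) α (X + Y) ∎
  where
  G : ℕ → ℚ
  G i = p i α Y * p (suc m ∸ i) α X
  lower-X : sumTo m (λ i → ⟦ m C i ⟧ * G i) ≡ X * p m α ((X + α) + Y)
  lower-X = begin
    sumTo m (λ i → ⟦ m C i ⟧ * G i)
      ≡⟨ sumTo-cong≤ m pull-X ⟩
    sumTo m (λ i → X * (⟦ m C i ⟧ * p i α Y * p (m ∸ i) α (X + α)))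
      ≡⟨ sumTo-*ˡ m X _ ⟩
    X * sumTo m (λ i → ⟦ m C i ⟧ * p i α Y * p (m ∸ i) α (X + α))
      ≡⟨ cong (X *_) (p-vandermonde α m (X + α) Y) ⟩
    X * p m α ((X + α) + Y) ∎
    where
    pull-X : ∀ i → i ≤ m → ⟦ m C i ⟧ * G i ≡ X * (⟦ m C i ⟧ * p i α Y * p (m ∸ i) α (X + α))
    pull-X i i≤m = begin
      ⟦ m C i ⟧ * (p i α Y * p (suc m ∸ i) α X)
        ≡⟨ cong (λ t → ⟦ m C i ⟧ * (p i α Y * p t α X)) (ℕP.+-∸-assoc 1 i≤m) ⟩
      ⟦ m C i ⟧ * (p i α Y * p (suc (m ∸ i)) α X)
        ≡⟨ cong (λ t → ⟦ m C i ⟧ * (p i α Y * t)) (p-sucˡ α (m ∸ i) X) ⟩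
      ⟦ m C i ⟧ * (p i α Y * (X * p (m ∸ i) α (X + α)))
        ≡⟨ solve 4 (λ c q x r → c :* (q :* (x :* r)) := x :* (c :* q :* r))
             refl ⟦ m C i ⟧ (p i α Y) X (p (m ∸ i) α (X + α)) ⟩
      X * (⟦ m C i ⟧ * p i α Y * p (m ∸ i) α (X + α)) ∎
  upper-Y : sumTo m (λ i → ⟦ m C i ⟧ * G (suc i)) ≡ Y * p m α (X + (Y + α))
  upper-Y = begin
    sumTo m (λ i → ⟦ m C i ⟧ * G (suc i))
      ≡⟨ sumTo-cong m pull-Y ⟩
    sumTo m (λ i → Y * (⟦ m C i ⟧ * p i α (Y + α) * p (m ∸ i) α X))
      ≡⟨ sumTo-*ˡ m Y _ ⟩
    Y * sumTo m (λ i → ⟦ m C i ⟧ * p i α (Y + α) * p (m ∸ i) α X)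
      ≡⟨ cong (Y *_) (p-vandermonde α m X (Y + α)) ⟩
    Y * p m α (X + (Y + α)) ∎
    where
    pull-Y : ∀ i → ⟦ m C i ⟧ * G (suc i) ≡ Y * (⟦ m C i ⟧ * p i α (Y + α) * p (m ∸ i) α X)
    pull-Y i = begin
      ⟦ m C i ⟧ * (p (suc i) α Y * p (m ∸ i) α X)
        ≡⟨ cong (λ t → ⟦ m C i ⟧ * (t * p (m ∸ i) α X)) (p-sucˡ α i Y) ⟩
      ⟦ m C i ⟧ * ((Y * p i α (Y + α)) * p (m ∸ i) α X)
        ≡⟨ solve 4 (λ c y q r → c :* ((y :* q) :* r) := y :* (c :* q :* r))
             refl ⟦ m C i ⟧ Y (p i α (Y + α)) (p (m ∸ i) α X) ⟩
      Y * (⟦ m C i ⟧ * p i α (Y + α) * p (m ∸ i) α X) ∎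

-- Variables matched against refl are abbreviations: Z₁ = Z₂ + α, K₂ = K₁ + 1, J₂ = J₁ + 1, and
-- B₃ + B₄ = B₂, B₂ + B₁ = A are the two Pascal rules. Only the absorption rule is a genuine
-- constraint; the two sides differ by a multiple of it.
recurrence-identity : ∀ α Z₂ V K₁ J₁ B₁ B₃ B₄ {Z₁ K₂ J₂ A B₂ c₁ c₂ : ℚ} →
  Z₂ + α ≡ Z₁ → K₁ + 1ℚ ≡ K₂ → J₁ + 1ℚ ≡ J₂ → B₂ + B₁ ≡ A → B₃ + B₄ ≡ B₂ →
  α * K₂ - Z₁ ≡ c₁ → - (α * Z₁ * K₁) ≡ c₂ → J₂ * B₁ ≡ K₁ * B₄ →
  A * (Z₂ * (Z₁ * V))
    ≡ (B₁ * ((Z₁ * V) * (Z₁ + α * J₁)) - c₁ * (B₂ * (Z₁ * V))) - c₂ * (B₃ * V)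
recurrence-identity α Z₂ V K₁ J₁ B₁ B₃ B₄
  refl refl refl refl refl refl refl absorb = begin
  LHS                                   ≡⟨ solve 8 (λ a z v k j b₁ b₃ b₄ →
      ((b₃ :+ b₄) :+ b₁) :* (z :* ((z :+ a) :* v))
      := (((b₁ :* (((z :+ a) :* v) :* ((z :+ a) :+ a :* j)))
          :- ((a :* (k :+ con 1ℚ) :- (z :+ a)) :* ((b₃ :+ b₄) :* ((z :+ a) :* v))))
          :- ((:- (a :* (z :+ a) :* k)) :* (b₃ :* v)))
         :+ (:- (a :* (z :+ a) :* v)) :* ((j :+ con 1ℚ) :* b₁ :- k :* b₄))
      refl α Z₂ V K₁ J₁ B₁ B₃ B₄ ⟩
  RHS + E * ((J₁ + 1ℚ) * B₁ - K₁ * B₄) ≡⟨ cong (λ t → RHS + E * (t - K₁ * B₄)) absorb ⟩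
  RHS + E * (K₁ * B₄ - K₁ * B₄)         ≡⟨ solve 3 (λ x e y → x :+ e :* (y :- y) := x) refl RHS E (K₁ * B₄) ⟩
  RHS                                   ∎
  where
  Z₁ = Z₂ + α
  LHS = ((B₃ + B₄) + B₁) * (Z₂ * (Z₁ * V))
  RHS = (B₁ * ((Z₁ * V) * (Z₁ + α * J₁)) - (α * (K₁ + 1ℚ) - Z₁) * ((B₃ + B₄) * (Z₁ * V)))
        - (- (α * Z₁ * K₁)) * (B₃ * V)
  E = - (α * Z₁ * V)

_≈_below_ : Poly → Poly → ℕ → Set
f ≈ g below m = ∀ n → n < m → f n ≡ g n

≈below-suc : ∀ {f g m} → f ≈ g below m → f m ≡ g m → f ≈ g below suc m
≈below-suc f≈g fm≡gm n n<1+m with ℕP.m≤n⇒m<n∨m≡n (ℕP.≤-pred n<1+m)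
... | inj₁ n<m  = f≈g n n<m
... | inj₂ refl = fm≡gm

≈below-pred : ∀ {f g m} → f ≈ g below suc m → f ≈ g below m
≈below-pred f≈g n n<m = f≈g n (ℕP.m≤n⇒m≤1+n n<m)

zShift-≈below : ∀ {f g m} → f ≈ g below m → zShift f ≈ zShift g below suc m
zShift-≈below f≈g zero    _         = refl
zShift-≈below f≈g (suc n) (s≤s n<m) = f≈g n n<m

zShift-cong : ∀ {f g : Poly} → (∀ n → f n ≡ g n) → ∀ n → zShift f n ≡ zShift g n
zShift-cong f≗g zero    = refl
zShift-cong f≗g (suc n) = f≗g n

module Series (α R : ℚ) where

  B : ℕ → ℚ
  B m = p m α R

  -- coefficients of f(z) · Σₘ pₘ(α,R) zᵐ
  mulB : Poly → Poly
  mulB f n = sumTo n (λ i → f i * B (n ∸ i))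

  mulB-cong : ∀ {f g} → (∀ i → f i ≡ g i) → ∀ n → mulB f n ≡ mulB g n
  mulB-cong f≗g n = sumTo-cong n (λ i → cong (_* B (n ∸ i)) (f≗g i))

  mulB-⊖ : ∀ f g n → mulB (f ⊖ g) n ≡ mulB f n - mulB g n
  mulB-⊖ f g n = trans (sumTo-cong n distrib) (sumTo-- n _ _)
    where
    distrib : ∀ i → (f i - g i) * B (n ∸ i) ≡ f i * B (n ∸ i) - g i * B (n ∸ i)
    distrib i = solve 3 (λ x y b → (x :- y) :* b := x :* b :- y :* b) refl (f i) (g i) (B (n ∸ i))

  mulB-· : ∀ c f n → mulB (c · f) n ≡ c * mulB f n
  mulB-· c f n = trans (sumTo-cong n (λ i → ℚP.*-assoc c (f i) (B (n ∸ i)))) (sumTo-*ˡ n c _)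

  mulB-zShift : ∀ f n → mulB (zShift f) n ≡ zShift (mulB f) n
  mulB-zShift f zero    = ℚP.*-zeroˡ (B 0)
  mulB-zShift f (suc n) = trans (sumTo-sucˡ n _)
    (trans (cong (_+ mulB f n) (ℚP.*-zeroˡ (B (suc n)))) (ℚP.+-identityˡ (mulB f n)))

  -- one step of the recurrence defining P, so that P α R (k+2) = step k (P α R (k+1)) (P α R k)
  c₁ c₂ : ℕ → ℚ
  c₁ k = R + ⟦ 2 ⟧ * α * ⟦ suc k ⟧
  c₂ k = α * (R + α * ⟦ k ⟧) * ⟦ suc k ⟧

  step : ℕ → Poly → Poly → Poly
  step k f g = (f ⊖ (c₁ k · zShift f)) ⊖ (c₂ k · zShift (zShift g))

  step-≈below : ∀ k m {f f′ g g′} → f ≈ f′ below suc (suc m) → g ≈ g′ below m →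
    step k f g ≈ step k f′ g′ below suc (suc m)
  step-≈below k m f≈f′ g≈g′ n n<m+2 =
    cong₂ _-_ (cong₂ _-_ (f≈f′ n n<m+2) (cong (c₁ k *_) (zShift-≈below (≈below-pred f≈f′) n n<m+2)))
              (cong (c₂ k *_) (zShift-≈below (zShift-≈below g≈g′) n n<m+2))

  mulB-step : ∀ k f g n → mulB (step k f g) n ≡ step k (mulB f) (mulB g) n
  mulB-step k f g n = begin
    mulB (step k f g) n
      ≡⟨ mulB-⊖ (f ⊖ (c₁ k · zShift f)) (c₂ k · zShift (zShift g)) n ⟩
    mulB (f ⊖ (c₁ k · zShift f)) n - mulB (c₂ k · zShift (zShift g)) n
      ≡⟨ cong₂ _-_ (mulB-⊖ f (c₁ k · zShift f) n) (mulB-· (c₂ k) (zShift (zShift g)) n) ⟩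
    (mulB f n - mulB (c₁ k · zShift f) n) - c₂ k * mulB (zShift (zShift g)) n
      ≡⟨ cong₂ (λ x y → (mulB f n - x) - c₂ k * y) (mulB-· (c₁ k) (zShift f) n) (mulB-zShift (zShift g) n) ⟩
    (mulB f n - c₁ k * mulB (zShift f) n) - c₂ k * zShift (mulB (zShift g)) n
      ≡⟨ cong₂ (λ x y → (mulB f n - c₁ k * x) - c₂ k * y)
           (mulB-zShift f n) (zShift-cong (mulB-zShift g) n) ⟩
    step k (mulB f) (mulB g) n ∎

  P-degree : ∀ h n → h ≤ n → P α R h n ≡ 0ℚ
  P-degree zero          n             _                 = refl
  P-degree (suc zero)    (suc n)       _                 = refl
  P-degree (suc (suc k)) (suc (suc m)) (s≤s (s≤s k≤m)) = begin
    (P α R (suc k) (suc (suc m)) - c₁ k * P α R (suc k) (suc m)) - c₂ k * P α R k m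
      ≡⟨ cong₂ (λ x y → (x - c₁ k * y) - c₂ k * P α R k m)
           (P-degree (suc k) (suc (suc m)) (s≤s (ℕP.m≤n⇒m≤1+n k≤m))) (P-degree (suc k) (suc m) (s≤s k≤m)) ⟩
    (0ℚ - c₁ k * 0ℚ) - c₂ k * P α R k m
      ≡⟨ cong (λ y → (0ℚ - c₁ k * 0ℚ) - c₂ k * y) (P-degree k m k≤m) ⟩
    (0ℚ - c₁ k * 0ℚ) - c₂ k * 0ℚ
      ≡⟨ solve 2 (λ c d → (con 0ℚ :- c :* con 0ℚ) :- d :* con 0ℚ := con 0ℚ) refl (c₁ k) (c₂ k) ⟩
    0ℚ ∎

  -- −(R + (h−1)α) with h − 1 computed in ℚ rather than ℕ, so that Z-suc holds also at h = 0
  Z : ℕ → ℚ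
  Z h = α - (R + ⟦ h ⟧ * α)

  U : ℕ → Poly
  U h i = ⟦ h C i ⟧ * p i α (Z h)

  T : ℕ → Poly
  T h = mulB (U h)

  Z-suc : ∀ h → Z (suc h) + α ≡ Z h
  Z-suc h = begin
    (α - (R + ⟦ suc h ⟧ * α)) + α  ≡⟨ cong (λ t → (α - (R + t * α)) + α) (⟦⟧-suc h) ⟩
    (α - (R + (⟦ h ⟧ + 1ℚ) * α)) + α
      ≡⟨ solve 3 (λ a r m → (a :- (r :+ (m :+ con 1ℚ) :* a)) :+ a := a :- (r :+ m :* a)) refl α R ⟦ h ⟧ ⟩
    α - (R + ⟦ h ⟧ * α)            ∎

  Z-pred : ∀ h → Z (suc h) ≡ Z h - α
  Z-pred h = begin
    Z (suc h)              ≡⟨ solve 2 (λ z a → z := (z :+ a) :- a) refl (Z (suc h)) α ⟩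
    (Z (suc h) + α) - α    ≡⟨ cong (_- α) (Z-suc h) ⟩
    Z h - α                ∎

  Z-suc≡- : ∀ h → Z (suc h) ≡ - (R + ⟦ h ⟧ * α)
  Z-suc≡- h = trans (Z-pred h)
    (solve 3 (λ a r m → (a :- (r :+ m :* a)) :- a := :- (r :+ m :* a)) refl α R ⟦ h ⟧)

  p-Z : ∀ n h → p (suc n) α (Z (suc h)) ≡ Z (suc h) * p n α (Z h)
  p-Z n h = trans (p-sucˡ α n (Z (suc h))) (cong (λ t → Z (suc h) * p n α t) (Z-suc h))

  U-step : ∀ k i → U (suc (suc k)) i ≡ step k (U (suc k)) (U k) i
  U-step k zero =
    solve 3 (λ x c d → x := (x :- c :* con 0ℚ) :- d :* con 0ℚ) refl (U (suc (suc k)) 0) (c₁ k) (c₂ k)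
  U-step k (suc zero) = begin
    ⟦ suc (suc k) C 1 ⟧ * (1ℚ * (Z (suc (suc k)) + α * 0ℚ))
      ≡⟨ cong₂ (λ c z → c * (1ℚ * (z + α * 0ℚ)))
           (trans (cong ⟦_⟧ (ℕC.nC1≡n (suc (suc k)))) (⟦⟧-suc (suc k))) (Z-pred (suc k)) ⟩
    (⟦ suc k ⟧ + 1ℚ) * (1ℚ * ((Z (suc k) - α) + α * 0ℚ))
      ≡⟨ solve 4 (λ m r a d →
           (m :+ con 1ℚ) :* (con 1ℚ :* ((a :- (r :+ m :* a)) :- a :+ a :* con 0ℚ))
           := (m :* (con 1ℚ :* ((a :- (r :+ m :* a)) :+ a :* con 0ℚ))
               :- (r :+ (con 1ℚ :+ con 1ℚ) :* a :* m) :* (con 1ℚ :* con 1ℚ)) :- d :* con 0ℚ)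
           refl ⟦ suc k ⟧ R α (c₂ k) ⟩
    (⟦ suc k ⟧ * (1ℚ * (Z (suc k) + α * 0ℚ)) - c₁ k * (1ℚ * 1ℚ)) - c₂ k * 0ℚ
      ≡⟨ cong (λ c → (c * (1ℚ * (Z (suc k) + α * 0ℚ)) - c₁ k * (1ℚ * 1ℚ)) - c₂ k * 0ℚ)
           (cong ⟦_⟧ (sym (ℕC.nC1≡n (suc k)))) ⟩
    step k (U (suc k)) (U k) 1 ∎
  U-step k (suc (suc j)) = begin
    ⟦ suc (suc k) C suc (suc j) ⟧ * p (suc (suc j)) α (Z (suc (suc k)))
      ≡⟨ cong (⟦ suc (suc k) C suc (suc j) ⟧ *_)
           (trans (p-Z (suc j) (suc k)) (cong (Z (suc (suc k)) *_) (p-Z j k))) ⟩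
    ⟦ suc (suc k) C suc (suc j) ⟧ * (Z (suc (suc k)) * (Z (suc k) * V))
      ≡⟨ recurrence-identity α (Z (suc (suc k))) V ⟦ suc k ⟧ ⟦ suc j ⟧
           ⟦ suc k C suc (suc j) ⟧ ⟦ k C j ⟧ ⟦ k C suc j ⟧ (Z-suc (suc k)) (sym (⟦⟧-suc (suc k))) (sym (⟦⟧-suc (suc j)))
           (pascal-⟦⟧ (suc k) (suc j)) (pascal-⟦⟧ k j) c₁-via-Z c₂-via-Z (absorption-⟦⟧ k (suc j)) ⟩
    (⟦ suc k C suc (suc j) ⟧ * ((Z (suc k) * V) * (Z (suc k) + α * ⟦ suc j ⟧))
      - c₁ k * (⟦ suc k C suc j ⟧ * (Z (suc k) * V))) - c₂ k * (⟦ k C j ⟧ * V)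
      ≡⟨ cong (λ t → (⟦ suc k C suc (suc j) ⟧ * (t * (Z (suc k) + α * ⟦ suc j ⟧))
                      - c₁ k * (⟦ suc k C suc j ⟧ * t)) - c₂ k * (⟦ k C j ⟧ * V))
           (sym (p-Z j k)) ⟩
    step k (U (suc k)) (U k) (suc (suc j)) ∎
    where
    V = p j α (Z k)
    c₁-via-Z : α * ⟦ suc (suc k) ⟧ - Z (suc k) ≡ c₁ k
    c₁-via-Z = begin
      α * ⟦ suc (suc k) ⟧ - Z (suc k)   ≡⟨ cong (λ t → α * t - Z (suc k)) (⟦⟧-suc (suc k)) ⟩
      α * (⟦ suc k ⟧ + 1ℚ) - (α - (R + ⟦ suc k ⟧ * α))
        ≡⟨ solve 3 (λ a r m → a :* (m :+ con 1ℚ) :- (a :- (r :+ m :* a)) := r :+ (con 1ℚ :+ con 1ℚ) :* a :* m)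
             refl α R ⟦ suc k ⟧ ⟩
      c₁ k ∎
    c₂-via-Z : - (α * Z (suc k) * ⟦ suc k ⟧) ≡ c₂ k
    c₂-via-Z = begin
      - (α * Z (suc k) * ⟦ suc k ⟧)             ≡⟨ cong (λ t → - (α * t * ⟦ suc k ⟧)) (Z-suc≡- k) ⟩
      - (α * (- (R + ⟦ k ⟧ * α)) * ⟦ suc k ⟧)
        ≡⟨ solve 4 (λ a r m n → :- (a :* (:- (r :+ m :* a)) :* n) := a :* (r :+ a :* m) :* n)
             refl α R ⟦ k ⟧ ⟦ suc k ⟧ ⟩
      c₂ k ∎

  T-step : ∀ k n → T (suc (suc k)) n ≡ step k (T (suc k)) (T k) n
  T-step k n = trans (mulB-cong (U-step k) n) (mulB-step k (U (suc k)) (U k) n)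

  -- [z^(k+1)] T_(k+1) = p_(k+1)(α, R + Z_(k+1)) and the last factor of that product is 0.
  T-top : ∀ k → T (suc k) (suc k) ≡ 0ℚ
  T-top k = begin
    T (suc k) (suc k)                  ≡⟨ p-vandermonde α (suc k) R (Z (suc k)) ⟩
    p k α W * (W + α * ⟦ k ⟧)          ≡⟨ cong (λ t → p k α W * (R + t + α * ⟦ k ⟧)) (Z-suc≡- k) ⟩
    p k α W * (R + - (R + ⟦ k ⟧ * α) + α * ⟦ k ⟧)
      ≡⟨ solve 4 (λ q r m a → q :* (r :+ :- (r :+ m :* a) :+ a :* m) := con 0ℚ) refl (p k α W) R ⟦ k ⟧ α ⟩
    0ℚ                                 ∎
    where
    W = R + Z (suc k)

  P≈T : ∀ h → P α R h ≈ T h below h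
  P≈T zero          n       ()
  P≈T (suc zero)    zero    _ = refl
  P≈T (suc zero)    (suc n) (s≤s ())
  P≈T (suc (suc k)) n n<k+2 = begin
    step k (P α R (suc k)) (P α R k) n  ≡⟨ step-≈below k k (≈below-suc (P≈T (suc k)) top) (P≈T k) n n<k+2 ⟩
    step k (T (suc k)) (T k) n          ≡⟨ sym (T-step k n) ⟩
    T (suc (suc k)) n                   ∎
    where
    top : P α R (suc k) (suc k) ≡ T (suc k) (suc k)
    top = trans (P-degree (suc k) (suc k) ℕP.≤-refl) (sym (T-top k))

  T-sgn-form : ∀ h n →
    T (suc h) n ≡ sumTo n (λ i → ⟦ suc h C i ⟧ * sgn i * p i (- α) (R + ⟦ h ⟧ * α) * p (n ∸ i) α R)
  T-sgn-form h n = sumTo-cong n (λ i → cong (_* B (n ∸ i)) (begin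
    ⟦ suc h C i ⟧ * p i α (Z (suc h))                    ≡⟨ cong (λ t → ⟦ suc h C i ⟧ * p i α t) (Z-suc≡- h) ⟩
    ⟦ suc h C i ⟧ * p i α (- (R + ⟦ h ⟧ * α))            ≡⟨ cong (⟦ suc h C i ⟧ *_) (sym (sgn*p-neg α _ i)) ⟩
    ⟦ suc h C i ⟧ * (sgn i * p i (- α) (R + ⟦ h ⟧ * α))  ≡⟨ sym (ℚP.*-assoc ⟦ suc h C i ⟧ _ _) ⟩
    ⟦ suc h C i ⟧ * sgn i * p i (- α) (R + ⟦ h ⟧ * α)    ∎))

  T-poch-form : ∀ h n x y → α * x ≡ R → α * y ≡ Z h →
    T h n ≡ pow α n * sumTo n (λ i → ⟦ h C i ⟧ * poch y i * poch x (n ∸ i))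
  T-poch-form h n x y refl αy≡Z = trans (sumTo-cong≤ n term) (sumTo-*ˡ n (pow α n) _)
    where
    term : ∀ i → i ≤ n → U h i * B (n ∸ i) ≡ pow α n * (⟦ h C i ⟧ * poch y i * poch x (n ∸ i))
    term i i≤n = begin
      ⟦ h C i ⟧ * p i α (Z h) * p (n ∸ i) α (α * x)
        ≡⟨ cong (λ t → ⟦ h C i ⟧ * p i α t * p (n ∸ i) α (α * x)) (sym αy≡Z) ⟩
      ⟦ h C i ⟧ * p i α (α * y) * p (n ∸ i) α (α * x)
        ≡⟨ cong₂ (λ s t → ⟦ h C i ⟧ * s * t) (p≡pow*poch α y i) (p≡pow*poch α x (n ∸ i)) ⟩
      ⟦ h C i ⟧ * (pow α i * poch y i) * (pow α (n ∸ i) * poch x (n ∸ i))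
        ≡⟨ solve 5 (λ c w q w′ q′ → c :* (w :* q) :* (w′ :* q′) := (w :* w′) :* (c :* q :* q′))
             refl ⟦ h C i ⟧ (pow α i) (poch y i) (pow α (n ∸ i)) (poch x (n ∸ i)) ⟩
      (pow α i * pow α (n ∸ i)) * (⟦ h C i ⟧ * poch y i * poch x (n ∸ i))
        ≡⟨ cong (_* (⟦ h C i ⟧ * poch y i * poch x (n ∸ i)))
             (trans (sym (pow-+ α i (n ∸ i))) (cong (pow α) (ℕP.m+[n∸m]≡n i≤n))) ⟩
      pow α n * (⟦ h C i ⟧ * poch y i * poch x (n ∸ i)) ∎

mainTheorem7 : (α : ℕ) → .{{_ : NonZero α}} → (R : ℚ) → (h n : ℕ) → n < h →
    (coeffC ⟦ α ⟧ R h n ≡ sumTo n (λ i → ⟦ h C i ⟧ * sgn i * p i (- ⟦ α ⟧) (R + ⟦ h ∸ 1 ⟧ * ⟦ α ⟧) * p (n ∸ i) ⟦ α ⟧ R))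
    × (coeffC ⟦ α ⟧ R h n ≡ pow ⟦ α ⟧ n * sumTo n (λ i → ⟦ h C i ⟧ * poch (1ℚ - ⟦ h ⟧ - R * ((+ 1) / α)) i * poch (R * ((+ 1) / α)) (n ∸ i)))
mainTheorem7 α R zero    n ()
mainTheorem7 α R (suc h) n n<h =
  trans P≡T (T-sgn-form h n) , trans P≡T (T-poch-form (suc h) n x (1ℚ - ⟦ suc h ⟧ - x) αx≡R αy≡Z)
  where
  open Series ⟦ α ⟧ R
  P≡T = P≈T (suc h) n n<h
  x = R * ((+ 1) / α)
  αx≡R : ⟦ α ⟧ * x ≡ R
  αx≡R = begin
    ⟦ α ⟧ * (R * ((+ 1) / α))  ≡⟨ solve 3 (λ a r q → a :* (r :* q) := r :* (a :* q)) refl ⟦ α ⟧ R ((+ 1) / α) ⟩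
    R * (⟦ α ⟧ * ((+ 1) / α))  ≡⟨ cong (R *_) (⟦⟧*1/≡1 α) ⟩
    R * 1ℚ                     ≡⟨ ℚP.*-identityʳ R ⟩
    R                          ∎
  αy≡Z : ⟦ α ⟧ * (1ℚ - ⟦ suc h ⟧ - x) ≡ Z (suc h)
  αy≡Z = trans (solve 3 (λ a m x → a :* ((con 1ℚ :- m) :- x) := a :- (a :* x :+ m :* a)) refl ⟦ α ⟧ ⟦ suc h ⟧ x)
               (cong (λ t → ⟦ α ⟧ - (t + ⟦ suc h ⟧ * ⟦ α ⟧)) αx≡R)
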